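{- For every integer $n\ge 2$, $\alpha(K_e(cp(n)))=4$.
   Context: The cocktail party graph $cp(n)$ is the complement of a perfect matching on $2n$ vertices. The edge-clique graph $K_e(G)$ of a graph $G$ has the edges of $G$ as its vertices, two of them adjacent when the corresponding edges are contained in a common clique of $G$. $\alpha$ denotes the independence number. -}

module Defs where

open import Data.Nat using (ℕ; _*_; _≤_)
open import Data.Nat.DivMod using (_/_)
open import Data.Fin using (Fin; toℕ; _<_)
open import Data.Fin.Subset using (Subset; _∈_)
open import Data.Product using (Σ; _×_; _,_; ∃)
open import Data.List using (List; length)
open import Data.List.Relation.Unary.All using (All)
open import Data.List.Relation.Unary.Unique.Propositional using (Unique)
import Data.List.Membership.Propositional as Mem
open import Relation.Binary.PropositionalEquality using (_≡_; _≢_)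
open import Relation.Nullary using (¬_)

record Graph (m : ℕ) : Set₁ where
  field
    Adj   : Fin m → Fin m → Set
    sym   : ∀ {u v} → Adj u v → Adj v u
    irrefl : ∀ {u} → ¬ Adj u u
open Graph public

-- Cocktail party graph cp(n): vertex set Fin (2n) with the perfect matching
-- {2k, 2k+1} (k < n); two vertices are adjacent iff they are distinct and
-- do not form an edge of that matching.
InMatching : ∀ n → Fin (2 * n) → Fin (2 * n) → Set
InMatching n u v = u ≢ v × toℕ u / 2 ≡ toℕ v / 2

cpAdj : ∀ n → Fin (2 * n) → Fin (2 * n) → Set
cpAdj n u v = u ≢ v × ¬ InMatching n u v

cp : (n : ℕ) → Graph (2 * n)
cp n = record
  { Adj = cpAdj n
  ; sym = λ { (u≢v , ¬m) → (λ e → u≢v (Relation.Binary.PropositionalEquality.sym e))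
                          , (λ { (a , b) → ¬m ((λ e → a (Relation.Binary.PropositionalEquality.sym e))
                                              , Relation.Binary.PropositionalEquality.sym b) }) }
  ; irrefl = λ { (u≢u , _) → u≢u _≡_.refl }
  }

IsClique : ∀ {m} → Graph m → Subset m → Set
IsClique G S = ∀ x y → x ∈ S → y ∈ S → x ≢ y → Adj G x y

-- An edge {u,v} of G, represented canonically as the ordered pair (u , v)
-- with u < v.
IsEdge : ∀ {m} → Graph m → Fin m × Fin m → Set
IsEdge G (u , v) = u < v × Adj G u v

KeAdj : ∀ {m} → Graph m → Fin m × Fin m → Fin m × Fin m → Set
KeAdj G (u , v) (x , y) =
  (u , v) ≢ (x , y) ×
  Σ (Subset m) (λ S → IsClique G S × u ∈ S × v ∈ S × x ∈ S × y ∈ S)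
  where m = _

IsKeIndependent : ∀ {m} → Graph m → List (Fin m × Fin m) → Set
IsKeIndependent G I =
  Unique I × All (IsEdge G) I ×
  (∀ {e f} → e Mem.∈ I → f Mem.∈ I → ¬ KeAdj G e f)

αKe≡ : ∀ {m} → Graph m → ℕ → Set
αKe≡ G k =
  Σ (List _) (λ I → IsKeIndependent G I × length I ≡ k) ×
  (∀ I → IsKeIndependent G I → length I ≤ k)

-- In cp(n) a set of vertices is a clique iff it contains no matched pair, so
-- two distinct edges are non-adjacent in K_e(cp(n)) iff they conflict: an end
-- of one is matched to an end of the other.  The edges 02, 03, 12, 13 of the
-- 4-cycle cp(2) conflict pairwise, and cp(2) embeds in cp(n).  Among five
-- pairwise conflicting edges, the first, ab, forces each of the other four to
-- contain the partner a' of a or the partner b' of b.  Three edges through a'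
-- conflict pairwise only if their other ends are matched pairwise, impossible
-- in a matching; and two edges a'x, a'x' with two edges b'y, b'y' force x to
-- be matched to both y and y', since every other way for them to conflict puts
-- a' or b' on a third edge.
module Submission where

open import Defs hiding (sym; irrefl)
open import Level using (0ℓ)
open import Data.Nat as ℕ using (ℕ; _≤_; _+_; _*_; _/_; z≤n; s≤s; NonZero)
open import Data.Nat.DivMod using (_mod_; _divMod_; DivMod)
open import Data.Nat.Properties using (*-monoʳ-≤)
open import Data.Fin as Fin using (Fin; zero; suc; toℕ; inject≤; #_)
open import Data.Fin.Properties using (toℕ-injective; toℕ-inject≤; inject≤-injective)
open import Data.Fin.Subset using (Subset; _∈_; _∪_; ⁅_⁆)
open import Data.Fin.Subset.Properties using (x∈p∪q⁺; x∈p∪q⁻; x∈⁅x⁆; x∈⁅y⁆⇒x≡y)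
open import Data.Product as Prod using (∃; ∃₂; _×_; _,_; proj₂)
open import Data.Sum as Sum using (_⊎_; inj₁; inj₂)
open import Data.Empty using (⊥; ⊥-elim)
open import Data.List using (List; []; _∷_; length; map)
open import Data.List.Relation.Unary.All as All using (All; []; _∷_; all?)
import Data.List.Relation.Unary.All.Properties as Allₚ
open import Data.List.Relation.Unary.AllPairs as AllPairs using (AllPairs; []; _∷_; allPairs?)
import Data.List.Relation.Unary.AllPairs.Properties as AllPairsₚ
open import Data.List.Relation.Unary.Any using (here; there)
open import Data.List.Relation.Unary.Unique.Propositional using (Unique)
open import Data.List.Membership.Propositional using () renaming (_∈_ to _∈ₗ_)
open import Data.List.Membership.Propositional.Properties using (∈-AllPairs₂)
open import Function using (_∘_; id)
open import Relation.Binary.Core using (Rel)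
open import Relation.Binary.Definitions using (Irreflexive; Symmetric; Decidable)
open import Relation.Binary.PropositionalEquality as ≡
  using (_≡_; _≢_; refl; cong; cong₂; subst; subst₂; module ≡-Reasoning)
open import Relation.Nullary using (¬_; Dec)
open import Relation.Nullary.Decidable
  using (map′; _⊎-dec_; _×-dec_; ¬?; decidable-stable; from-yes)

module _ {E : Set} {C : Rel E 0ℓ} (C-sym : Symmetric C) {A B : E → Set}
  (no-AAA  : ∀ {f g h} → A f → A g → A h → C f g → C f h → C g h → ⊥)
  (no-BBB  : ∀ {f g h} → B f → B g → B h → C f g → C f h → C g h → ⊥)
  (no-AABB : ∀ {f g h k} → A f → A g → B h → B k →
             C f g → C f h → C f k → C g h → C g k → C h k → ⊥)
  where

  no-two-coloured-4-clique : ∀ {f g h k} → A f ⊎ B f → A g ⊎ B g → A h ⊎ B h → A k ⊎ B k →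
    C f g → C f h → C f k → C g h → C g k → C h k → ⊥
  no-two-coloured-4-clique (inj₁ f) (inj₁ g) (inj₁ h) _ c₁₂ c₁₃ c₁₄ c₂₃ c₂₄ c₃₄ = no-AAA f g h c₁₂ c₁₃ c₂₃
  no-two-coloured-4-clique (inj₂ f) (inj₂ g) (inj₂ h) _ c₁₂ c₁₃ c₁₄ c₂₃ c₂₄ c₃₄ = no-BBB f g h c₁₂ c₁₃ c₂₃
  no-two-coloured-4-clique (inj₁ f) (inj₁ g) (inj₂ h) (inj₁ k) c₁₂ c₁₃ c₁₄ c₂₃ c₂₄ c₃₄ =
    no-AAA f g k c₁₂ c₁₄ c₂₄
  no-two-coloured-4-clique (inj₁ f) (inj₁ g) (inj₂ h) (inj₂ k) c₁₂ c₁₃ c₁₄ c₂₃ c₂₄ c₃₄ =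
    no-AABB f g h k c₁₂ c₁₃ c₁₄ c₂₃ c₂₄ c₃₄
  no-two-coloured-4-clique (inj₁ f) (inj₂ g) (inj₁ h) (inj₁ k) c₁₂ c₁₃ c₁₄ c₂₃ c₂₄ c₃₄ =
    no-AAA f h k c₁₃ c₁₄ c₃₄
  no-two-coloured-4-clique (inj₁ f) (inj₂ g) (inj₁ h) (inj₂ k) c₁₂ c₁₃ c₁₄ c₂₃ c₂₄ c₃₄ =
    no-AABB f h g k c₁₃ c₁₂ c₁₄ (C-sym c₂₃) c₃₄ c₂₄
  no-two-coloured-4-clique (inj₁ f) (inj₂ g) (inj₂ h) (inj₁ k) c₁₂ c₁₃ c₁₄ c₂₃ c₂₄ c₃₄ =
    no-AABB f k g h c₁₄ c₁₂ c₁₃ (C-sym c₂₄) (C-sym c₃₄) c₂₃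
  no-two-coloured-4-clique (inj₁ f) (inj₂ g) (inj₂ h) (inj₂ k) c₁₂ c₁₃ c₁₄ c₂₃ c₂₄ c₃₄ =
    no-BBB g h k c₂₃ c₂₄ c₃₄
  no-two-coloured-4-clique (inj₂ f) (inj₁ g) (inj₁ h) (inj₁ k) c₁₂ c₁₃ c₁₄ c₂₃ c₂₄ c₃₄ =
    no-AAA g h k c₂₃ c₂₄ c₃₄
  no-two-coloured-4-clique (inj₂ f) (inj₁ g) (inj₁ h) (inj₂ k) c₁₂ c₁₃ c₁₄ c₂₃ c₂₄ c₃₄ =
    no-AABB g h f k c₂₃ (C-sym c₁₂) c₂₄ (C-sym c₁₃) c₃₄ c₁₄
  no-two-coloured-4-clique (inj₂ f) (inj₁ g) (inj₂ h) (inj₁ k) c₁₂ c₁₃ c₁₄ c₂₃ c₂₄ c₃₄ =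
    no-AABB g k f h c₂₄ (C-sym c₁₂) c₂₃ (C-sym c₁₄) (C-sym c₃₄) c₁₃
  no-two-coloured-4-clique (inj₂ f) (inj₁ g) (inj₂ h) (inj₂ k) c₁₂ c₁₃ c₁₄ c₂₃ c₂₄ c₃₄ =
    no-BBB f h k c₁₃ c₁₄ c₃₄
  no-two-coloured-4-clique (inj₂ f) (inj₂ g) (inj₁ h) (inj₁ k) c₁₂ c₁₃ c₁₄ c₂₃ c₂₄ c₃₄ =
    no-AABB h k f g c₃₄ (C-sym c₁₃) (C-sym c₂₃) (C-sym c₁₄) (C-sym c₂₄) c₁₂
  no-two-coloured-4-clique (inj₂ f) (inj₂ g) (inj₁ h) (inj₂ k) c₁₂ c₁₃ c₁₄ c₂₃ c₂₄ c₃₄ =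
    no-BBB f g k c₁₂ c₁₄ c₂₄

record IsMatching {V : Set} (M : Rel V 0ℓ) : Set where
  field
    irrefl     : Irreflexive _≡_ M
    sym        : Symmetric M
    functional : ∀ {p q r} → M p q → M p r → q ≡ r

module Matching {V : Set} {M : Rel V 0ℓ} (isMatching : IsMatching M) where
  open IsMatching isMatching

  Pair : Set
  Pair = V × V

  infix 4 _∈₂_ _⊆₂_

  _∈₂_ : V → Pair → Set
  w ∈₂ (u , v) = w ≡ u ⊎ w ≡ v

  _⊆₂_ : Rel Pair 0ℓ
  e ⊆₂ f = ∀ {w} → w ∈₂ e → w ∈₂ f

  Conflict : Rel Pair 0ℓ
  Conflict e f = ∃₂ λ p q → p ∈₂ e × q ∈₂ f × M p q

  MatchFree : Pair → Set
  MatchFree e = ¬ Conflict e e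

  PartnerIn : V → Pair → Set
  PartnerIn a f = ∃ λ a' → M a a' × a' ∈₂ f

  rebase : ∀ {w e} → w ∈₂ e → ∃ λ x → e ⊆₂ (w , x) × (w , x) ⊆₂ e
  rebase {e = _ , v} (inj₁ refl) = v , id , id
  rebase {e = u , _} (inj₂ refl) = u , Sum.swap , Sum.swap

  conflict-mono : ∀ {e e' f f'} → e ⊆₂ e' → f ⊆₂ f' → Conflict e f → Conflict e' f'
  conflict-mono e⊆e' f⊆f' (p , q , p∈e , q∈f , m) = p , q , e⊆e' p∈e , f⊆f' q∈f , m

  matchFree-anti : ∀ {e e'} → e ⊆₂ e' → MatchFree e' → MatchFree e
  matchFree-anti e⊆e' mf = mf ∘ conflict-mono e⊆e' e⊆e'

  conflict-sym : Symmetric Conflict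
  conflict-sym (p , q , p∈e , q∈f , m) = q , p , q∈f , p∈e , sym m

  conflict⇒cases : ∀ {u v x y} → Conflict (u , v) (x , y) → M u x ⊎ M u y ⊎ M v x ⊎ M v y
  conflict⇒cases (_ , _ , inj₁ refl , inj₁ refl , m) = inj₁ m
  conflict⇒cases (_ , _ , inj₁ refl , inj₂ refl , m) = inj₂ (inj₁ m)
  conflict⇒cases (_ , _ , inj₂ refl , inj₁ refl , m) = inj₂ (inj₂ (inj₁ m))
  conflict⇒cases (_ , _ , inj₂ refl , inj₂ refl , m) = inj₂ (inj₂ (inj₂ m))

  cases⇒conflict : ∀ {u v x y} → M u x ⊎ M u y ⊎ M v x ⊎ M v y → Conflict (u , v) (x , y)
  cases⇒conflict (inj₁ m)                 = _ , _ , inj₁ refl , inj₁ refl , m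
  cases⇒conflict (inj₂ (inj₁ m))          = _ , _ , inj₁ refl , inj₂ refl , m
  cases⇒conflict (inj₂ (inj₂ (inj₁ m)))   = _ , _ , inj₂ refl , inj₁ refl , m
  cases⇒conflict (inj₂ (inj₂ (inj₂ m)))   = _ , _ , inj₂ refl , inj₂ refl , m

  conflict? : Decidable M → Decidable Conflict
  conflict? M? (u , v) (x , y) =
    map′ cases⇒conflict conflict⇒cases (M? u x ⊎-dec M? u y ⊎-dec M? v x ⊎-dec M? v y)

  conflict⇒partnerIn : ∀ {a b f} → Conflict (a , b) f → PartnerIn a f ⊎ PartnerIn b f
  conflict⇒partnerIn (_ , q , inj₁ refl , q∈f , m) = inj₁ (q , m , q∈f)
  conflict⇒partnerIn (_ , q , inj₂ refl , q∈f , m) = inj₂ (q , m , q∈f)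

  conflict-at-common-end : ∀ {w p q} → MatchFree (w , p) → MatchFree (w , q) →
                           Conflict (w , p) (w , q) → M p q
  conflict-at-common-end mf-wp mf-wq c with conflict⇒cases c
  ... | inj₁ mww                 = ⊥-elim (irrefl refl mww)
  ... | inj₂ (inj₁ mwq)          = ⊥-elim (mf-wq (_ , _ , inj₁ refl , inj₂ refl , mwq))
  ... | inj₂ (inj₂ (inj₁ mpw))   = ⊥-elim (mf-wp (_ , _ , inj₂ refl , inj₁ refl , mpw))
  ... | inj₂ (inj₂ (inj₂ mpq))   = mpq

  no-conflict-triangle-at : ∀ {w f g h} → w ∈₂ f → w ∈₂ g → w ∈₂ h →
    MatchFree f → MatchFree g → MatchFree h →
    Conflict f g → Conflict f h → Conflict g h → ⊥
  no-conflict-triangle-at w∈f w∈g w∈h mf mg mh cfg cfh cgh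
    with rebase w∈f | rebase w∈g | rebase w∈h
  ... | _ , f⊆ , ⊆f | _ , g⊆ , ⊆g | _ , h⊆ , ⊆h =
    irrefl (functional (partners f⊆ ⊆f mf g⊆ ⊆g mg cfg) (partners f⊆ ⊆f mf h⊆ ⊆h mh cfh))
           (partners g⊆ ⊆g mg h⊆ ⊆h mh cgh)
    where
      partners : ∀ {w x y e f} → e ⊆₂ (w , x) → (w , x) ⊆₂ e → MatchFree e →
                 f ⊆₂ (w , y) → (w , y) ⊆₂ f → MatchFree f → Conflict e f → M x y
      partners e⊆ ⊆e me f⊆ ⊆f mf c =
        conflict-at-common-end (matchFree-anti ⊆e me) (matchFree-anti ⊆f mf) (conflict-mono e⊆ f⊆ c)

  no-conflict-triangle-through : ∀ {a f g h} → PartnerIn a f → PartnerIn a g → PartnerIn a h →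
    MatchFree f → MatchFree g → MatchFree h →
    Conflict f g → Conflict f h → Conflict g h → ⊥
  no-conflict-triangle-through (_ , m₁ , ∈f) (_ , m₂ , ∈g) (_ , m₃ , ∈h)
    with functional m₁ m₂ | functional m₁ m₃
  ... | refl | refl = no-conflict-triangle-at ∈f ∈g ∈h

  no-conflict-square-at : ∀ {a b a' b' x x' y y'} → ¬ M b a → M a a' → M b b' →
    MatchFree (a' , x) → MatchFree (a' , x') → MatchFree (b' , y) → MatchFree (b' , y') →
    Conflict (a' , x) (a' , x') → Conflict (a' , x) (b' , y) → Conflict (a' , x) (b' , y') →
    Conflict (a' , x') (b' , y) → Conflict (a' , x') (b' , y') → Conflict (b' , y) (b' , y') → ⊥
  no-conflict-square-at {b = b} {a'} {b'} {x} {x'} ¬mba maa' mbb' mf₁ mf₂ mf₃ mf₄ c₁₂ c₁₃ c₁₄ c₂₃ c₂₄ c₃₄ =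
    irrefl (functional (x-matched myy' mf₃ mf₄ c₁₃ c₁₄ c₂₃ c₂₄ c₃₄)
                       (x-matched (sym myy') mf₄ mf₃ c₁₄ c₁₃ c₂₄ c₂₃ (conflict-sym c₃₄)))
           myy'
    where
      mxx' = conflict-at-common-end mf₁ mf₂ c₁₂
      myy' = conflict-at-common-end mf₃ mf₄ c₃₄
      x-matched : ∀ {z z'} → M z z' → MatchFree (b' , z) → MatchFree (b' , z') →
        Conflict (a' , x) (b' , z) → Conflict (a' , x) (b' , z') →
        Conflict (a' , x') (b' , z) → Conflict (a' , x') (b' , z') →
        Conflict (b' , z) (b' , z') → M x z
      x-matched mzz' mfz mfz' c₁z c₁z' c₂z c₂z' czz' with conflict⇒cases c₁z
      ... | inj₁ ma'b' = ⊥-elim (¬mba (subst (M b) (≡.sym (functional (sym maa') ma'b')) mbb'))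
      ... | inj₂ (inj₁ ma'z) = ⊥-elim (no-conflict-triangle-at
              (inj₁ refl) (inj₁ refl) (inj₂ (functional (sym ma'z) mzz')) mf₁ mf₂ mfz' c₁₂ c₁z' c₂z')
      ... | inj₂ (inj₂ (inj₁ mxb')) = ⊥-elim (no-conflict-triangle-at
              (inj₂ (functional mxb' mxx')) (inj₁ refl) (inj₁ refl) mf₂ mfz mfz' c₂z c₂z' czz')
      ... | inj₂ (inj₂ (inj₂ mxz)) = mxz

  no-conflict-square-through : ∀ {a b f g h k} → MatchFree (a , b) →
    PartnerIn a f → PartnerIn a g → PartnerIn b h → PartnerIn b k →
    MatchFree f → MatchFree g → MatchFree h → MatchFree k →
    Conflict f g → Conflict f h → Conflict f k → Conflict g h → Conflict g k → Conflict h k → ⊥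
  no-conflict-square-through mf-ab (_ , maa' , a'∈f) (_ , maa'' , a''∈g) (_ , mbb' , b'∈h) (_ , mbb'' , b''∈k)
                             mf mg mh mk cfg cfh cfk cgh cgk chk
    with functional maa' maa'' | functional mbb' mbb''
  ... | refl | refl with rebase a'∈f | rebase a''∈g | rebase b'∈h | rebase b''∈k
  ... | _ , f⊆ , ⊆f | _ , g⊆ , ⊆g | _ , h⊆ , ⊆h | _ , k⊆ , ⊆k =
    no-conflict-square-at (mf-ab ∘ λ mba → _ , _ , inj₂ refl , inj₁ refl , mba) maa' mbb'
      (matchFree-anti ⊆f mf) (matchFree-anti ⊆g mg) (matchFree-anti ⊆h mh) (matchFree-anti ⊆k mk)
      (conflict-mono f⊆ g⊆ cfg) (conflict-mono f⊆ h⊆ cfh) (conflict-mono f⊆ k⊆ cfk)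
      (conflict-mono g⊆ h⊆ cgh) (conflict-mono g⊆ k⊆ cgk) (conflict-mono h⊆ k⊆ chk)

  no-five-pairwise-conflicting : ∀ {e₁ e₂ e₃ e₄ e₅ es} →
    All MatchFree (e₁ ∷ e₂ ∷ e₃ ∷ e₄ ∷ e₅ ∷ es) → AllPairs Conflict (e₁ ∷ e₂ ∷ e₃ ∷ e₄ ∷ e₅ ∷ es) → ⊥
  no-five-pairwise-conflicting {a , b} (mf₁ ∷ mf₂ ∷ mf₃ ∷ mf₄ ∷ mf₅ ∷ _)
    ((c₁₂ ∷ c₁₃ ∷ c₁₄ ∷ c₁₅ ∷ _) ∷ (c₂₃ ∷ c₂₄ ∷ c₂₅ ∷ _) ∷ (c₃₄ ∷ c₃₅ ∷ _) ∷ (c₄₅ ∷ _) ∷ _) =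
    no-two-coloured-4-clique conflict-sym {A = Edge-through a} {B = Edge-through b}
      (λ (mf , pf) (mg , pg) (mh , ph) → no-conflict-triangle-through pf pg ph mf mg mh)
      (λ (mf , pf) (mg , pg) (mh , ph) → no-conflict-triangle-through pf pg ph mf mg mh)
      (λ (mf , pf) (mg , pg) (mh , ph) (mk , pk) → no-conflict-square-through mf₁ pf pg ph pk mf mg mh mk)
      (colour mf₂ c₁₂) (colour mf₃ c₁₃) (colour mf₄ c₁₄) (colour mf₅ c₁₅)
      c₂₃ c₂₄ c₂₅ c₃₄ c₃₅ c₄₅
    where
      Edge-through : V → Pair → Set
      Edge-through x f = MatchFree f × PartnerIn x f
      colour : ∀ {f} → MatchFree f → Conflict (a , b) f → Edge-through a f ⊎ Edge-through b f
      colour mf c = Sum.[ (λ pa → inj₁ (mf , pa)) , (λ pb → inj₂ (mf , pb)) ]′ (conflict⇒partnerIn c)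

  pairwiseConflicting-length≤4 : ∀ {es} → All MatchFree es → AllPairs Conflict es → length es ≤ 4
  pairwiseConflicting-length≤4 {[]}                    _ _ = z≤n
  pairwiseConflicting-length≤4 {_ ∷ []}                _ _ = s≤s z≤n
  pairwiseConflicting-length≤4 {_ ∷ _ ∷ []}            _ _ = s≤s (s≤s z≤n)
  pairwiseConflicting-length≤4 {_ ∷ _ ∷ _ ∷ []}        _ _ = s≤s (s≤s (s≤s z≤n))
  pairwiseConflicting-length≤4 {_ ∷ _ ∷ _ ∷ _ ∷ []}    _ _ = s≤s (s≤s (s≤s (s≤s z≤n)))
  pairwiseConflicting-length≤4 {_ ∷ _ ∷ _ ∷ _ ∷ _ ∷ _} mfs cs = ⊥-elim (no-five-pairwise-conflicting mfs cs)

complementOf : ∀ {m} {M : Rel (Fin m) 0ℓ} → Symmetric M → Graph m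
complementOf {M = M} M-sym = record
  { Adj    = λ u v → u ≢ v × ¬ M u v
  ; sym    = λ (u≢v , ¬muv) → u≢v ∘ ≡.sym , ¬muv ∘ M-sym
  ; irrefl = λ (u≢u , _) → u≢u refl
  }

module MatchingComplement {m} {M : Rel (Fin m) 0ℓ} (isMatching : IsMatching M) (M? : Decidable M) where
  open IsMatching isMatching
  open Matching isMatching

  G : Graph m
  G = complementOf {M = M} sym

  isEdge⇒matchFree : ∀ {e} → IsEdge G e → MatchFree e
  isEdge⇒matchFree {_ , _} (_ , _ , ¬muv) c with conflict⇒cases c
  ... | inj₁ muu                 = irrefl refl muu
  ... | inj₂ (inj₁ muv)          = ¬muv muv
  ... | inj₂ (inj₂ (inj₁ mvu))   = ¬muv (sym mvu)
  ... | inj₂ (inj₂ (inj₂ mvv))   = irrefl refl mvv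

  ends : Pair → Subset m
  ends (u , v) = ⁅ u ⁆ ∪ ⁅ v ⁆

  ∈ends⁺ : ∀ {w e} → w ∈₂ e → w ∈ ends e
  ∈ends⁺ {e = u , _} (inj₁ refl) = x∈p∪q⁺ (inj₁ (x∈⁅x⁆ u))
  ∈ends⁺ {e = _ , v} (inj₂ refl) = x∈p∪q⁺ (inj₂ (x∈⁅x⁆ v))

  ∈ends⁻ : ∀ {w e} → w ∈ ends e → w ∈₂ e
  ∈ends⁻ {e = u , v} w∈ = Sum.map (x∈⁅y⁆⇒x≡y u) (x∈⁅y⁆⇒x≡y v) (x∈p∪q⁻ ⁅ u ⁆ ⁅ v ⁆ w∈)

  conflict⇒¬KeAdj : ∀ {e f} → Conflict e f → ¬ KeAdj G e f
  conflict⇒¬KeAdj (p , q , p∈e , q∈f , mpq) (_ , S , clique , u∈S , v∈S , x∈S , y∈S) =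
    proj₂ (clique p q (∈S u∈S v∈S p∈e) (∈S x∈S y∈S q∈f) (λ p≡q → irrefl p≡q mpq)) mpq
    where
      ∈S : ∀ {S : Subset m} {w u v} → u ∈ S → v ∈ S → w ∈₂ (u , v) → w ∈ S
      ∈S u∈S _ (inj₁ refl) = u∈S
      ∈S _ v∈S (inj₂ refl) = v∈S

  ¬conflict⇒KeAdj : ∀ {e f} → e ≢ f → MatchFree e → MatchFree f → ¬ Conflict e f → KeAdj G e f
  ¬conflict⇒KeAdj {e} {f} e≢f mf-e mf-f ¬c =
    e≢f , ends e ∪ ends f , clique ,
    inˡ (inj₁ refl) , inˡ (inj₂ refl) , inʳ (inj₁ refl) , inʳ (inj₂ refl)
    where
      inˡ : ∀ {w} → w ∈₂ e → w ∈ ends e ∪ ends f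
      inˡ = x∈p∪q⁺ ∘ inj₁ ∘ ∈ends⁺
      inʳ : ∀ {w} → w ∈₂ f → w ∈ ends e ∪ ends f
      inʳ = x∈p∪q⁺ ∘ inj₂ ∘ ∈ends⁺
      unmatched : ∀ {p q} → p ∈ ends e ∪ ends f → q ∈ ends e ∪ ends f → ¬ M p q
      unmatched p∈ q∈ m with x∈p∪q⁻ (ends e) (ends f) p∈ | x∈p∪q⁻ (ends e) (ends f) q∈
      ... | inj₁ p∈e | inj₁ q∈e = mf-e (_ , _ , ∈ends⁻ p∈e , ∈ends⁻ q∈e , m)
      ... | inj₁ p∈e | inj₂ q∈f = ¬c (_ , _ , ∈ends⁻ p∈e , ∈ends⁻ q∈f , m)
      ... | inj₂ p∈f | inj₁ q∈e = ¬c (_ , _ , ∈ends⁻ q∈e , ∈ends⁻ p∈f , sym m)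
      ... | inj₂ p∈f | inj₂ q∈f = mf-f (_ , _ , ∈ends⁻ p∈f , ∈ends⁻ q∈f , m)
      clique : IsClique G (ends e ∪ ends f)
      clique p q p∈ q∈ p≢q = p≢q , unmatched p∈ q∈

  ¬KeAdj⇒conflict : ∀ {e f} → e ≢ f → MatchFree e → MatchFree f → ¬ KeAdj G e f → Conflict e f
  ¬KeAdj⇒conflict {e} {f} e≢f mf-e mf-f ¬adj =
    decidable-stable (conflict? M? e f) (¬adj ∘ ¬conflict⇒KeAdj e≢f mf-e mf-f)

  independent⇒pairwiseConflicting : ∀ {es} → IsKeIndependent G es → AllPairs Conflict es
  independent⇒pairwiseConflicting {[]} _ = []
  independent⇒pairwiseConflicting {e ∷ es} (e≢es ∷ unique , e-edge ∷ edges , ¬adj) =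
    All.tabulate (λ f∈es → ¬KeAdj⇒conflict (All.lookup e≢es f∈es) (isEdge⇒matchFree e-edge)
                             (isEdge⇒matchFree (All.lookup edges f∈es)) (¬adj (here refl) (there f∈es)))
    ∷ independent⇒pairwiseConflicting (unique , edges , λ e∈ f∈ → ¬adj (there e∈) (there f∈))

  pairwiseConflicting⇒independent : ∀ {es} → All (IsEdge G) es → AllPairs Conflict es →
                                    IsKeIndependent G es
  pairwiseConflicting⇒independent {es} edges cs =
    unique (All.map isEdge⇒matchFree edges) cs , edges , nonadjacent
    where
      unique : ∀ {es} → All MatchFree es → AllPairs Conflict es → Unique es
      unique [] [] = []
      unique (mf ∷ mfs) (c ∷ cs) = All.map (λ { c' refl → mf c' }) c ∷ unique mfs cs
      nonadjacent : ∀ {e f} → e ∈ₗ es → f ∈ₗ es → ¬ KeAdj G e f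
      nonadjacent e∈ f∈ with ∈-AllPairs₂ cs e∈ f∈
      ... | inj₁ refl        = λ (e≢e , _) → e≢e refl
      ... | inj₂ (inj₁ c)    = conflict⇒¬KeAdj c
      ... | inj₂ (inj₂ c)    = conflict⇒¬KeAdj (conflict-sym c)

  independent-length≤4 : ∀ es → IsKeIndependent G es → length es ≤ 4
  independent-length≤4 _ independent@(_ , edges , _) =
    pairwiseConflicting-length≤4 (All.map isEdge⇒matchFree edges)
                                 (independent⇒pairwiseConflicting independent)

fin2-pigeonhole : (r s t : Fin 2) → r ≡ s ⊎ r ≡ t ⊎ s ≡ t
fin2-pigeonhole zero       zero       _          = inj₁ refl
fin2-pigeonhole (suc zero) (suc zero) _          = inj₁ refl
fin2-pigeonhole zero       (suc zero) zero       = inj₂ (inj₁ refl)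
fin2-pigeonhole zero       (suc zero) (suc zero) = inj₂ (inj₂ refl)
fin2-pigeonhole (suc zero) zero       zero       = inj₂ (inj₂ refl)
fin2-pigeonhole (suc zero) zero       (suc zero) = inj₂ (inj₁ refl)

/-mod-injective : ∀ {m n} d .{{_ : NonZero d}} → m / d ≡ n / d → m mod d ≡ n mod d → m ≡ n
/-mod-injective {m} {n} d m/d≡n/d m%d≡n%d = begin
  m                            ≡⟨ DivMod.property (m divMod d) ⟩
  toℕ (m mod d) + m / d * d    ≡⟨ cong₂ (λ r q → toℕ r + q * d) m%d≡n%d m/d≡n/d ⟩
  toℕ (n mod d) + n / d * d    ≡⟨ DivMod.property (n divMod d) ⟨
  n                            ∎
  where open ≡-Reasoning

equal-halves-pigeonhole : ∀ {i j k} → i / 2 ≡ j / 2 → i / 2 ≡ k / 2 → i ≡ j ⊎ i ≡ k ⊎ j ≡ k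
equal-halves-pigeonhole {i} {j} {k} i~j i~k with fin2-pigeonhole (i mod 2) (j mod 2) (k mod 2)
... | inj₁ ij        = inj₁ (/-mod-injective 2 i~j ij)
... | inj₂ (inj₁ ik) = inj₂ (inj₁ (/-mod-injective 2 i~k ik))
... | inj₂ (inj₂ jk) = inj₂ (inj₂ (/-mod-injective 2 (≡.trans (≡.sym i~j) i~k) jk))

inMatching-isMatching : ∀ n → IsMatching (InMatching n)
inMatching-isMatching n = record
  { irrefl     = λ u≡v (u≢v , _) → u≢v u≡v
  ; sym        = λ (u≢v , u~v) → u≢v ∘ ≡.sym , ≡.sym u~v
  ; functional = functional
  }
  where
    functional : ∀ {p q r} → InMatching n p q → InMatching n p r → q ≡ r
    functional (p≢q , p~q) (p≢r , p~r) with equal-halves-pigeonhole p~q p~r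
    ... | inj₁ p≡q        = ⊥-elim (p≢q (toℕ-injective p≡q))
    ... | inj₂ (inj₁ p≡r) = ⊥-elim (p≢r (toℕ-injective p≡r))
    ... | inj₂ (inj₂ q≡r) = toℕ-injective q≡r

inMatching? : ∀ n → Decidable (InMatching n)
inMatching? n u v = ¬? (u Fin.≟ v) ×-dec (toℕ u / 2 ℕ.≟ toℕ v / 2)

inMatching-toℕ : ∀ {k n} {u v : Fin (2 * k)} {u' v' : Fin (2 * n)} →
                 toℕ u ≡ toℕ u' → toℕ v ≡ toℕ v' → InMatching k u v → InMatching n u' v'
inMatching-toℕ u≗u' v≗v' (u≢v , u~v) =
  (λ u'≡v' → u≢v (toℕ-injective (≡.trans u≗u' (≡.trans (cong toℕ u'≡v') (≡.sym v≗v'))))) ,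
  subst₂ (λ s t → s / 2 ≡ t / 2) u≗u' v≗v' u~v

module Embedding {k n} (k≤n : k ≤ n) where
  module K = Matching (inMatching-isMatching k)
  module N = Matching (inMatching-isMatching n)

  2k≤2n : 2 * k ≤ 2 * n
  2k≤2n = *-monoʳ-≤ 2 k≤n

  ι : Fin (2 * k) → Fin (2 * n)
  ι i = inject≤ i 2k≤2n

  ι₂ : K.Pair → N.Pair
  ι₂ = Prod.map ι ι

  toℕ-ι : ∀ i → toℕ (ι i) ≡ toℕ i
  toℕ-ι i = toℕ-inject≤ i _

  isEdge-ι : ∀ {e} → IsEdge (cp k) e → IsEdge (cp n) (ι₂ e)
  isEdge-ι {u , v} (u<v , u≢v , ¬u~v) =
    subst₂ ℕ._<_ (≡.sym (toℕ-ι u)) (≡.sym (toℕ-ι v)) u<v ,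
    u≢v ∘ inject≤-injective 2k≤2n 2k≤2n u v ,
    ¬u~v ∘ inMatching-toℕ {n} {k} (toℕ-ι u) (toℕ-ι v)

  conflict-ι : ∀ {e f} → K.Conflict e f → N.Conflict (ι₂ e) (ι₂ f)
  conflict-ι (p , q , p∈e , q∈f , p~q) =
    ι p , ι q , Sum.map (cong ι) (cong ι) p∈e , Sum.map (cong ι) (cong ι) q∈f ,
    inMatching-toℕ {k} {n} (≡.sym (toℕ-ι p)) (≡.sym (toℕ-ι q)) p~q

C₄ : List (Fin 4 × Fin 4)
C₄ = (# 0 , # 2) ∷ (# 0 , # 3) ∷ (# 1 , # 2) ∷ (# 1 , # 3) ∷ []

C₄-edges : All (IsEdge (cp 2)) C₄
C₄-edges = from-yes (all? isEdge? C₄)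
  where
    isEdge? : ∀ e → Dec (IsEdge (cp 2) e)
    isEdge? (u , v) = (u Fin.<? v) ×-dec ¬? (u Fin.≟ v) ×-dec ¬? (inMatching? 2 u v)

C₄-pairwiseConflicting : AllPairs (Matching.Conflict (inMatching-isMatching 2)) C₄
C₄-pairwiseConflicting = from-yes (allPairs? (Matching.conflict? (inMatching-isMatching 2) (inMatching? 2)) C₄)

lemma6 : (n : ℕ) → 2 ≤ n → αKe≡ (cp n) 4
lemma6 n 2≤n = (map ι₂ C₄ , independent , refl) , independent-length≤4
  where
    -- cp n is definitionally the complement G of InMatching n.
    open MatchingComplement (inMatching-isMatching n) (inMatching? n)
    open Embedding 2≤n
    independent : IsKeIndependent G (map ι₂ C₄)
    independent = pairwiseConflicting⇒independent
      (Allₚ.map⁺ (All.map isEdge-ι C₄-edges))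
      (AllPairsₚ.map⁺ (AllPairs.map conflict-ι C₄-pairwiseConflicting))
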